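{- Let $H = \overline{P_5}$ be the house. Then $rb(K_n, H) \leq rb(K_n, K_{2,4})$ for all $n \geq 6$.
   Context: The house $H$ is the complement of the path $P_5$ on five vertices (a $5$-cycle with one chord). $K_{2,4}$ is the complete bipartite graph with parts of sizes $2$ and $4$. For a graph $F$ and an integer $n$, the rainbow number $rb(K_n,F)$ is the minimum number $m$ such that every edge-colouring of $K_n$ using at least $m$ colours contains a rainbow copy of $F$ (a subgraph isomorphic to $F$ whose edges all have distinct colours). -}

module Defs where

open import Data.Nat using (ℕ; _≤_; _≥_; _≟_)
open import Data.Fin using (Fin; zero; suc; _<?_; #_)
open import Data.Product using (_×_; _,_; Σ)
open import Data.List using (List; length; map; filter; concatMap; allFin; deduplicate)
open import Function.Definitions using (Injective)
open import Relation.Binary.PropositionalEquality using (_≡_)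

-- A finite simple graph given by its number of vertices, and an
-- enumeration of its (distinct, non-loop) edges.
record Graph : Set where
  field
    order  : ℕ
    size   : ℕ
    edge   : Fin size → Fin order × Fin order
open Graph public

-- An edge-colouring of K_n: a symmetric colour assignment to pairs of
-- vertices (colours are natural numbers; diagonal values are irrelevant).
record Colouring (n : ℕ) : Set where
  field
    col  : Fin n → Fin n → ℕ
    symm : ∀ u v → col u v ≡ col v u
open Colouring public

edgesK : (n : ℕ) → List (Fin n × Fin n)
edgesK n = concatMap (λ u → map (λ v → (u , v)) (filter (λ v → u <? v) (allFin n))) (allFin n)

numColours : ∀ {n} → Colouring n → ℕ
numColours {n} c = length (deduplicate _≟_ (map (λ e → col c (Data.Product.proj₁ e) (Data.Product.proj₂ e)) (edgesK n)))

RainbowCopy : ∀ {n} → Colouring n → Graph → Set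
RainbowCopy {n} c F =
  Σ (Fin (order F) → Fin n) λ φ →
    Injective _≡_ _≡_ φ ×
    (∀ i j → col c (φ (Data.Product.proj₁ (edge F i))) (φ (Data.Product.proj₂ (edge F i)))
           ≡ col c (φ (Data.Product.proj₁ (edge F j))) (φ (Data.Product.proj₂ (edge F j)))
           → i ≡ j)

Forces : ℕ → Graph → ℕ → Set
Forces n F m = (c : Colouring n) → numColours c ≥ m → RainbowCopy c F

IsRainbowNumber : ℕ → Graph → ℕ → Set
IsRainbowNumber n F m = Forces n F m × (∀ m' → Forces n F m' → m ≤ m')

-- The house: complement of the path P_5 = 0-1-2-3-4.
-- Its edges are the pairs {i,j} with |i-j| ≥ 2:
-- 02, 03, 04, 13, 14, 24.
house : Graph
house = record { order = 5 ; size = 6 ; edge = e }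
  where
  e : Fin 6 → Fin 5 × Fin 5
  e zero = (# 0 , # 2)
  e (suc zero) = (# 0 , # 3)
  e (suc (suc zero)) = (# 0 , # 4)
  e (suc (suc (suc zero))) = (# 1 , # 3)
  e (suc (suc (suc (suc zero)))) = (# 1 , # 4)
  e (suc (suc (suc (suc (suc zero))))) = (# 2 , # 4)

K24 : Graph
K24 = record { order = 6 ; size = 8 ; edge = e }
  where
  e : Fin 8 → Fin 6 × Fin 6
  e zero = (# 0 , # 2)
  e (suc zero) = (# 0 , # 3)
  e (suc (suc zero)) = (# 0 , # 4)
  e (suc (suc (suc zero))) = (# 0 , # 5)
  e (suc (suc (suc (suc zero)))) = (# 1 , # 2)
  e (suc (suc (suc (suc (suc zero))))) = (# 1 , # 3)
  e (suc (suc (suc (suc (suc (suc zero)))))) = (# 1 , # 4)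
  e (suc (suc (suc (suc (suc (suc (suc zero))))))) = (# 1 , # 5)

-- Look at the edge {2,3} inside the big part of a rainbow K_{2,4}. Its colour
-- agrees with at most one of the eight rainbow edges, say e. The house is
-- K_{2,3} minus one edge plus one edge inside the part of size 3, so it suffices
-- to pick x, y from the small part and r, s, p from the big part with {r, p} = {2, 3}
-- such that e is not among xr, xs, xp, ys, yp: then rp together with these five
-- edges is a rainbow house. So every colouring with a rainbow K_{2,4} has a
-- rainbow house, and rainbow numbers are monotone under such containment.
module Submission where

open import Defs
open import Data.Nat using (ℕ; _≤_; _≥_)
import Data.Nat as ℕ
open import Data.Fin using (Fin; zero; suc; #_; _≟_)
open import Data.Fin.Patterns using (0F; 1F; 2F; 3F; 4F; 5F; 6F; 7F)
open import Data.Fin.Properties using (all?; any?)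
open import Data.Vec using (Vec; []; _∷_; lookup)
open import Data.Product using (_×_; _,_; proj₁; proj₂; ∃)
open import Data.Sum using (_⊎_; inj₁; inj₂)
open import Data.Empty using (⊥-elim)
open import Function using (_∘_)
open import Function.Definitions using (Injective)
open import Relation.Nullary using (Dec; yes; no)
open import Relation.Nullary.Decidable using (from-yes; ¬?; _×-dec_; _⊎-dec_; _→-dec_)
open import Relation.Binary.Definitions using (DecidableEquality)
open import Relation.Binary.PropositionalEquality using (_≡_; _≢_; refl; sym; trans; cong)

private variable
  k m n : ℕ

cons-injective : {A : Set} {f : Fin (ℕ.suc m) → A} →
  Injective _≡_ _≡_ (f ∘ suc) → (∀ i → f (suc i) ≢ f zero) → Injective _≡_ _≡_ f
cons-injective inj fresh {zero}  {zero}  _  = refl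
cons-injective inj fresh {zero}  {suc j} eq = ⊥-elim (fresh j (sym eq))
cons-injective inj fresh {suc i} {zero}  eq = ⊥-elim (fresh i eq)
cons-injective inj fresh {suc i} {suc j} eq = cong suc (inj eq)

injective-fibre-⊆-singleton : {A : Set} → DecidableEquality A →
  (f : Fin (ℕ.suc m) → A) → Injective _≡_ _≡_ f →
  (x : A) → ∃ λ e → ∀ j → x ≡ f j → j ≡ e
injective-fibre-⊆-singleton _≟ᴬ_ f inj x with any? (λ j → x ≟ᴬ f j)
... | yes (e , x≡fe) = e , λ j x≡fj → inj (trans (sym x≡fj) x≡fe)
... | no  ∄j         = zero , λ j x≡fj → ⊥-elim (∄j (j , x≡fj))

injective? : (f : Fin m → Fin k) → Dec (∀ i j → f i ≡ f j → i ≡ j)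
injective? f = all? λ i → all? λ j → (f i ≟ f j) →-dec (i ≟ j)

SameEdge : Fin k × Fin k → Fin k × Fin k → Set
SameEdge (u , v) (u′ , v′) = (u ≡ u′ × v ≡ v′) ⊎ (u ≡ v′ × v ≡ u′)

sameEdge? : (e e′ : Fin k × Fin k) → Dec (SameEdge e e′)
sameEdge? (u , v) (u′ , v′) = ((u ≟ u′) ×-dec (v ≟ v′)) ⊎-dec ((u ≟ v′) ×-dec (v ≟ u′))

edgeImage : (σ : Fin k → Fin m) → Fin k × Fin k → Fin m × Fin m
edgeImage σ (u , v) = σ u , σ v

-- A placement avoiding the K_{2,4}-edge e: the images (p, s, r, y, x) of the house
-- vertices 0, …, 4, and the K_{2,4}-edges yp, xp, ys, xs, xr carrying the house
-- edges 1, …, 5 (K_{2,4}-edge 4a + b joins vertex a to vertex 2 + b).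
housePlacement : Fin 8 → Vec (Fin 6) 5 × Vec (Fin 8) 5
housePlacement 0F = (# 3 ∷ # 4 ∷ # 2 ∷ # 0 ∷ # 1 ∷ []) , (# 1 ∷ # 5 ∷ # 2 ∷ # 6 ∷ # 4 ∷ [])
housePlacement 1F = (# 2 ∷ # 4 ∷ # 3 ∷ # 0 ∷ # 1 ∷ []) , (# 0 ∷ # 4 ∷ # 2 ∷ # 6 ∷ # 5 ∷ [])
housePlacement 2F = (# 2 ∷ # 5 ∷ # 3 ∷ # 1 ∷ # 0 ∷ []) , (# 4 ∷ # 0 ∷ # 7 ∷ # 3 ∷ # 1 ∷ [])
housePlacement 3F = (# 2 ∷ # 4 ∷ # 3 ∷ # 1 ∷ # 0 ∷ []) , (# 4 ∷ # 0 ∷ # 6 ∷ # 2 ∷ # 1 ∷ [])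
housePlacement 4F = (# 3 ∷ # 4 ∷ # 2 ∷ # 1 ∷ # 0 ∷ []) , (# 5 ∷ # 1 ∷ # 6 ∷ # 2 ∷ # 0 ∷ [])
housePlacement 5F = (# 2 ∷ # 4 ∷ # 3 ∷ # 1 ∷ # 0 ∷ []) , (# 4 ∷ # 0 ∷ # 6 ∷ # 2 ∷ # 1 ∷ [])
housePlacement 6F = (# 2 ∷ # 5 ∷ # 3 ∷ # 1 ∷ # 0 ∷ []) , (# 4 ∷ # 0 ∷ # 7 ∷ # 3 ∷ # 1 ∷ [])
housePlacement 7F = (# 2 ∷ # 4 ∷ # 3 ∷ # 1 ∷ # 0 ∷ []) , (# 4 ∷ # 0 ∷ # 6 ∷ # 2 ∷ # 1 ∷ [])

vertexPlacement : Fin 8 → Fin 5 → Fin 6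
vertexPlacement e = lookup (proj₁ (housePlacement e))

edgePlacement : Fin 8 → Fin 5 → Fin 8
edgePlacement e = lookup (proj₂ (housePlacement e))

ValidPlacement : Fin 8 → (Fin 5 → Fin 6) → (Fin 5 → Fin 8) → Set
ValidPlacement e σ ι =
  (∀ i j → σ i ≡ σ j → i ≡ j) ×
  (∀ i j → ι i ≡ ι j → i ≡ j) ×
  (∀ i → ι i ≢ e) ×
  SameEdge (edgeImage σ (edge house zero)) (# 2 , # 3) ×
  (∀ i → SameEdge (edgeImage σ (edge house (suc i))) (edge K24 (ι i)))

validPlacement? : ∀ e σ ι → Dec (ValidPlacement e σ ι)
validPlacement? e σ ι =
  injective? σ ×-dec injective? ι ×-dec all? (λ i → ¬? (ι i ≟ e)) ×-dec
  sameEdge? (edgeImage σ (edge house zero)) (# 2 , # 3) ×-dec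
  all? (λ i → sameEdge? (edgeImage σ (edge house (suc i))) (edge K24 (ι i)))

housePlacement-valid : ∀ e → ValidPlacement e (vertexPlacement e) (edgePlacement e)
housePlacement-valid = from-yes (all? λ e → validPlacement? e (vertexPlacement e) (edgePlacement e))

module _ (c : Colouring n) where

  edgeColour : (F : Graph) → (Fin (order F) → Fin n) → Fin (size F) → ℕ
  edgeColour F φ i = col c (φ (proj₁ (edge F i))) (φ (proj₂ (edge F i)))

  col-sameEdge : (φ : Fin k → Fin n) {a b : Fin k × Fin k} → SameEdge a b →
    col c (φ (proj₁ a)) (φ (proj₂ a)) ≡ col c (φ (proj₁ b)) (φ (proj₂ b))
  col-sameEdge φ (inj₁ (refl , refl)) = refl
  col-sameEdge φ (inj₂ (refl , refl)) = symm c _ _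

  innerColour : (Fin 6 → Fin n) → ℕ
  innerColour φ = col c (φ (# 2)) (φ (# 3))

  module _ (φ : Fin 6 → Fin n) (φ-injective : Injective _≡_ _≡_ φ)
           (rainbow : ∀ i j → edgeColour K24 φ i ≡ edgeColour K24 φ j → i ≡ j) where

    placement⇒rainbowHouse : ∀ e {σ ι} →
      (∀ j → innerColour φ ≡ edgeColour K24 φ j → j ≡ e) →
      ValidPlacement e σ ι → RainbowCopy c house
    placement⇒rainbowHouse e {σ} {ι} unique (σ-injective , ι-injective , ι-avoids , extra , kept) =
      φ ∘ σ , σ-injective _ _ ∘ φ-injective ,
      λ i j → cons-injective tail-injective fresh {i} {j}
      where
      H : Fin 6 → ℕ
      H = edgeColour house (φ ∘ σ)

      H-zero : H zero ≡ innerColour φ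
      H-zero = col-sameEdge φ extra

      H-suc : ∀ i → H (suc i) ≡ edgeColour K24 φ (ι i)
      H-suc i = col-sameEdge φ (kept i)

      tail-injective : Injective _≡_ _≡_ (H ∘ suc)
      tail-injective {i} {j} eq =
        ι-injective i j (rainbow _ _ (trans (sym (H-suc i)) (trans eq (H-suc j))))

      fresh : ∀ i → H (suc i) ≢ H zero
      fresh i eq = ι-avoids i (unique (ι i) (trans (sym H-zero) (trans (sym eq) (H-suc i))))

  rainbowK24⇒rainbowHouse : RainbowCopy c K24 → RainbowCopy c house
  rainbowK24⇒rainbowHouse (φ , φ-injective , rainbow)
    with injective-fibre-⊆-singleton ℕ._≟_ (edgeColour K24 φ) (rainbow _ _) (innerColour φ)
  ... | e , unique =
    placement⇒rainbowHouse φ φ-injective rainbow e unique (housePlacement-valid e)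

rainbowNumber-mono : {F G : Graph} {a b : ℕ} →
  (∀ (c : Colouring n) → RainbowCopy c F → RainbowCopy c G) →
  IsRainbowNumber n G a → IsRainbowNumber n F b → a ≤ b
rainbowNumber-mono F⇒G (_ , minimal) (forcesF , _) =
  minimal _ (λ c many → F⇒G c (forcesF c many))

theorem12 : (n : ℕ) → n ≥ 6 → (a b : ℕ) →
    IsRainbowNumber n house a → IsRainbowNumber n K24 b → a ≤ b
theorem12 n _ a b = rainbowNumber-mono rainbowK24⇒rainbowHouse
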